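{- Define rows $R_n$ ($n\ge 0$) of pairs of integers (formal fractions, never reduced) by $R_0=(\frac{0}{1},\frac{1}{1})$, and let $R_{n+1}$ be obtained from $R_n$ by keeping all its terms in order and inserting between each pair of consecutive terms $\frac{a}{b},\frac{c}{d}$ the two formal fractions $\frac{2a+c}{2b+d}$ and $\frac{a+2c}{b+2d}$, in this order, without reducing. For $0\le i<3^n$ let $D_n(i)=bc-ad$, where $\frac{a}{b}$ and $\frac{c}{d}$ are the $i$-th and $(i+1)$-th terms of $R_n$ (terms indexed from $0$). Then $D_n(i)=3^{t(i)}$, where $t(i)$ is the number of digits equal to $1$ in the ternary (base-$3$) expansion of $i$.
   Context: $R_n$ has $3^n+1$ terms. -}

module Defs where

open import Data.Nat as ℕ using (ℕ; zero; suc; _%_; _/_)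
open import Data.Integer as ℤ using (ℤ; +_)
open import Data.List using (List; []; _∷_)
open import Data.Product using (_×_; _,_)
open import Data.Maybe using (Maybe; just; nothing)

-- A formal fraction a/b is the (never reduced) pair (a , b) of integers.
Frac : Set
Frac = ℤ × ℤ

refine : List Frac → List Frac
refine [] = []
refine (x ∷ []) = x ∷ []
refine ((a , b) ∷ (c , d) ∷ rest) =
  (a , b) ∷ (+ 2 ℤ.* a ℤ.+ c , + 2 ℤ.* b ℤ.+ d)
          ∷ (a ℤ.+ + 2 ℤ.* c , b ℤ.+ + 2 ℤ.* d)
          ∷ refine ((c , d) ∷ rest)

R : ℕ → List Frac
R zero = (+ 0 , + 1) ∷ (+ 1 , + 1) ∷ []
R (suc n) = refine (R n)

nth : {A : Set} → List A → ℕ → Maybe A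
nth [] _ = nothing
nth (x ∷ xs) zero = just x
nth (x ∷ xs) (suc i) = nth xs i

-- D n i = b c - a d where a/b, c/d are the i-th and (i+1)-th terms of R n
-- (defaults to 0 if out of range; only used for i < 3^n).
D : ℕ → ℕ → ℤ
D n i with nth (R n) i | nth (R n) (suc i)
... | just (a , b) | just (c , d) = b ℤ.* c ℤ.- a ℤ.* d
... | _ | _ = + 0

-- Number of digits equal to 1 in the base-3 expansion of m, computed with
-- fuel (fuel ≥ m suffices, since m / 3 < m for m > 0).
ones3-fuel : ℕ → ℕ → ℕ
ones3-fuel zero _ = 0
ones3-fuel (suc f) zero = 0
ones3-fuel (suc f) m@(suc _) with m % 3
... | 1 = suc (ones3-fuel f (m / 3))
... | _ = ones3-fuel f (m / 3)

ternaryOnes : ℕ → ℕ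
ternaryOnes m = ones3-fuel m m

-- Write i = 3j + r with r < 3. Refining a row replaces each consecutive pair p, q
-- by p, p′, q′, q, and the determinants of the three resulting consecutive pairs are
-- det(p, q), 3 det(p, q), det(p, q). Hence D (n+1) (3j+r) = 3^[r ≡ 1] · D n j, while the
-- ternary digits of 3j + r are those of j followed by r; induct on n.
module Submission where

open import Defs
open import Data.Nat using (ℕ; _<_; _^_)
open import Data.Integer using (+_)
open import Relation.Binary.PropositionalEquality using (_≡_)

open import Data.Nat as ℕ using (zero; suc; _≤_; z≤n; s≤s; _%_; _/_)
import Data.Nat.Properties as ℕ
open import Data.Nat.DivMod using (m%n<n; m/n<m; m≡m%n+[m/n]*n; m<n*o⇒m/o<n)
open import Data.Integer as ℤ using (ℤ)
import Data.Integer.Properties as ℤ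
open import Data.Integer.Tactic.RingSolver using (solve-∀)
open import Data.List using (List; []; _∷_)
open import Data.Maybe using (Maybe; just; nothing)
open import Data.Product using (_,_)
open import Relation.Binary.PropositionalEquality using (refl; sym; trans; cong; module ≡-Reasoning)

det : Frac → Frac → ℤ
det (a , b) (c , d) = b ℤ.* c ℤ.- a ℤ.* d

-- det (a , b) (c , d) with det unfolded: the reflective ring solver does not unfold det.
det-trisect-left : ∀ a b c d →
  b ℤ.* (+ 2 ℤ.* a ℤ.+ c) ℤ.- a ℤ.* (+ 2 ℤ.* b ℤ.+ d) ≡ b ℤ.* c ℤ.- a ℤ.* d
det-trisect-left = solve-∀

det-trisect-middle : ∀ a b c d →
  (+ 2 ℤ.* b ℤ.+ d) ℤ.* (a ℤ.+ + 2 ℤ.* c) ℤ.- (+ 2 ℤ.* a ℤ.+ c) ℤ.* (b ℤ.+ + 2 ℤ.* d)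
    ≡ + 3 ℤ.* (b ℤ.* c ℤ.- a ℤ.* d)
det-trisect-middle = solve-∀

det-trisect-right : ∀ a b c d →
  (b ℤ.+ + 2 ℤ.* d) ℤ.* c ℤ.- (a ℤ.+ + 2 ℤ.* c) ℤ.* d ≡ b ℤ.* c ℤ.- a ℤ.* d
det-trisect-right = solve-∀

detMaybe : Maybe Frac → Maybe Frac → ℤ
detMaybe (just p) (just q) = det p q
detMaybe _        _        = + 0

-- Missing terms give gap 0, so gap-refine below holds without any length hypothesis.
gap : List Frac → ℕ → ℤ
gap L i = detMaybe (nth L i) (nth L (suc i))

D≡gap : ∀ n i → D n i ≡ gap (R n) i
D≡gap n i with nth (R n) i | nth (R n) (suc i)
... | just _  | just _  = refl
... | just _  | nothing = refl
... | nothing | _       = refl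

gap-singleton : ∀ p i → gap (p ∷ []) i ≡ + 0
gap-singleton p zero    = refl
gap-singleton p (suc i) = refl

refine-head : ∀ p L → nth (refine (p ∷ L)) 0 ≡ just p
refine-head p []      = refl
refine-head p (_ ∷ _) = refl

gap-refine-pair : ∀ p q L r → r < 3 →
  gap (refine (p ∷ q ∷ L)) r ≡ + (3 ^ ternaryOnes r) ℤ.* det p q
gap-refine-pair (a , b) (c , d) L 0 _ =
  trans (det-trisect-left a b c d) (sym (ℤ.*-identityˡ _))
gap-refine-pair (a , b) (c , d) L 1 _ = det-trisect-middle a b c d
gap-refine-pair (a , b) (c , d) L 2 _ = begin
  detMaybe (just (a ℤ.+ + 2 ℤ.* c , b ℤ.+ + 2 ℤ.* d)) (nth (refine ((c , d) ∷ L)) 0)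
    ≡⟨ cong (detMaybe _) (refine-head (c , d) L) ⟩
  det (a ℤ.+ + 2 ℤ.* c , b ℤ.+ + 2 ℤ.* d) (c , d)  ≡⟨ det-trisect-right a b c d ⟩
  det (a , b) (c , d)                              ≡⟨ ℤ.*-identityˡ _ ⟨
  + 1 ℤ.* det (a , b) (c , d)                      ∎
  where open ≡-Reasoning
gap-refine-pair _ _ _ (suc (suc (suc _))) (s≤s (s≤s (s≤s ())))

gap-refine : ∀ L j r → r < 3 →
  gap (refine L) (j ℕ.* 3 ℕ.+ r) ≡ + (3 ^ ternaryOnes r) ℤ.* gap L j
gap-refine []          j       r _   = sym (ℤ.*-zeroʳ (+ (3 ^ ternaryOnes r)))
gap-refine (p ∷ [])    j       r _   = begin
  gap (p ∷ []) (j ℕ.* 3 ℕ.+ r)            ≡⟨ gap-singleton p (j ℕ.* 3 ℕ.+ r) ⟩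
  + 0                                      ≡⟨ ℤ.*-zeroʳ (+ (3 ^ ternaryOnes r)) ⟨
  + (3 ^ ternaryOnes r) ℤ.* + 0            ≡⟨ cong (+ (3 ^ ternaryOnes r) ℤ.*_) (gap-singleton p j) ⟨
  + (3 ^ ternaryOnes r) ℤ.* gap (p ∷ []) j ∎
  where open ≡-Reasoning
gap-refine (p ∷ q ∷ L) zero    r r<3 = gap-refine-pair p q L r r<3
gap-refine (p ∷ q ∷ L) (suc j) r r<3 = gap-refine (q ∷ L) j r r<3

ones3-fuel-step : ∀ f m →
  ones3-fuel (suc f) (suc m) ≡ ternaryOnes (suc m % 3) ℕ.+ ones3-fuel f (suc m / 3)
ones3-fuel-step f m with suc m % 3 | m%n<n (suc m) 3
... | 0 | _ = refl
... | 1 | _ = refl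
... | 2 | _ = refl
... | suc (suc (suc _)) | s≤s (s≤s (s≤s ()))

[1+m]/3≤ : ∀ {m k} → m ≤ k → suc m / 3 ≤ k
[1+m]/3≤ {m} m≤k = ℕ.≤-trans (ℕ.≤-pred (m/n<m (suc m) 3 (s≤s (s≤s z≤n)))) m≤k

ones3-fuel-irrelevant : ∀ f h m → m ≤ f → m ≤ h → ones3-fuel f m ≡ ones3-fuel h m
ones3-fuel-irrelevant zero    zero    zero    _ _ = refl
ones3-fuel-irrelevant zero    (suc h) zero    _ _ = refl
ones3-fuel-irrelevant (suc f) zero    zero    _ _ = refl
ones3-fuel-irrelevant (suc f) (suc h) zero    _ _ = refl
ones3-fuel-irrelevant (suc f) (suc h) (suc m) (s≤s m≤f) (s≤s m≤h) = begin
  ones3-fuel (suc f) (suc m)                               ≡⟨ ones3-fuel-step f m ⟩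
  ternaryOnes (suc m % 3) ℕ.+ ones3-fuel f (suc m / 3)
    ≡⟨ cong (ternaryOnes (suc m % 3) ℕ.+_)
            (ones3-fuel-irrelevant f h (suc m / 3) ([1+m]/3≤ m≤f) ([1+m]/3≤ m≤h)) ⟩
  ternaryOnes (suc m % 3) ℕ.+ ones3-fuel h (suc m / 3)    ≡⟨ ones3-fuel-step h m ⟨
  ones3-fuel (suc h) (suc m)                               ∎
  where open ≡-Reasoning

ternaryOnes-digits : ∀ m → ternaryOnes m ≡ ternaryOnes (m % 3) ℕ.+ ternaryOnes (m / 3)
ternaryOnes-digits zero    = refl
ternaryOnes-digits (suc m) =
  trans (ones3-fuel-step m m)
        (cong (ternaryOnes (suc m % 3) ℕ.+_)
              (ones3-fuel-irrelevant m (suc m / 3) (suc m / 3) ([1+m]/3≤ ℕ.≤-refl) ℕ.≤-refl))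

lemma6 : (n i : ℕ) → i < 3 ^ n → D n i ≡ + (3 ^ ternaryOnes i)
lemma6 zero    zero    _         = refl
lemma6 zero    (suc i) (s≤s ())
lemma6 (suc n) i       i<3^[1+n] = begin
  D (suc n) i                                        ≡⟨ D≡gap (suc n) i ⟩
  gap (refine (R n)) i                               ≡⟨ cong (gap (refine (R n))) i≡j*3+r ⟩
  gap (refine (R n)) (j ℕ.* 3 ℕ.+ r)                 ≡⟨ gap-refine (R n) j r (m%n<n i 3) ⟩
  + (3 ^ ternaryOnes r) ℤ.* gap (R n) j              ≡⟨ cong (+ (3 ^ ternaryOnes r) ℤ.*_) gap[R]j ⟩
  + (3 ^ ternaryOnes r) ℤ.* + (3 ^ ternaryOnes j)    ≡⟨ ℤ.pos-* (3 ^ ternaryOnes r) _ ⟨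
  + (3 ^ ternaryOnes r ℕ.* 3 ^ ternaryOnes j)        ≡⟨ cong +_ (ℕ.^-distribˡ-+-* 3 (ternaryOnes r) _) ⟨
  + (3 ^ (ternaryOnes r ℕ.+ ternaryOnes j))          ≡⟨ cong (λ t → + (3 ^ t)) (ternaryOnes-digits i) ⟨
  + (3 ^ ternaryOnes i)                              ∎
  where
  open ≡-Reasoning
  r = i % 3
  j = i / 3
  i≡j*3+r : i ≡ j ℕ.* 3 ℕ.+ r
  i≡j*3+r = trans (m≡m%n+[m/n]*n i 3) (ℕ.+-comm r (j ℕ.* 3))
  gap[R]j : gap (R n) j ≡ + (3 ^ ternaryOnes j)
  gap[R]j = trans (sym (D≡gap n j))
                  (lemma6 n j (m<n*o⇒m/o<n (ℕ.≤-trans i<3^[1+n] (ℕ.≤-reflexive (ℕ.*-comm 3 (3 ^ n))))))
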